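{- Let $N\le\omega$ and let $T\subseteq 2^{<\omega}$ be a tree with coding nodes $\langle c_n:n<N\rangle$, of lengths $l_n=|c_n|$ with $l_m<l_n$ whenever $m<n<N$, coding a countable graph $\mathrm{G}$ with vertices $\langle v_n:n<N\rangle$, meaning that for all $i<n<N$, $v_n$ and $v_i$ are adjacent if and only if $c_n(l_i)=1$. Assume the coding nodes are dense in $T$: for every $t\in T$ there is $n<N$ with $t\subseteq c_n$. Then the following are equivalent: (1) $\mathrm{G}$ is triangle-free; (2) $T$ satisfies the Triangle-Free Criterion: for every $t\in T$, every $n<N$ with $l_n<|t|$, and every $i<n$, if $t(l_i)=c_n(l_i)=1$ then $t(l_n)=0$.
   Context: $2^{<\omega}$ is the set of finite binary sequences $s:k\to\{0,1\}$, $k<\omega$, ordered by extension $\subseteq$; $|s|$ denotes the length (domain) of $s$. The meet $s\wedge t$ is the longest common initial segment of $s$ and $t$. A tree is a set $T\subseteq 2^{<\omega}$ closed under meets such that whenever $s,t\in T$ and $|s|\le|t|$, also $t\restriction|s|\in T$. A tree with coding nodes is a tree $T$ together with $N\le\omega$ and an injective map $n\mapsto c_n\in T$ ($n<N$) such that $m<n$ implies $|c_m|<|c_n|$; $c_n$ is the $n$-th coding node. -}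

module Defs where

open import Data.Nat using (ℕ; zero; suc; _<_; _≤_)
open import Data.Bool using (Bool; true; false; _≟_)
open import Data.List using (List; []; _∷_; length; take; _++_)
open import Data.Maybe using (Maybe; just; nothing)
open import Data.Product using (Σ; ∃; _×_; _,_)
open import Data.Empty using (⊥)
open import Data.Unit using (⊤)
open import Relation.Binary.PropositionalEquality using (_≡_; _≢_)
open import Relation.Nullary using (¬_; yes; no)
open import Function.Bundles using (_⇔_)

-- Finite binary sequences s : k → {0,1} are lists of booleans
-- (false = 0, true = 1); |s| = length s.
Seq : Set
Seq = List Bool

at : Seq → ℕ → Maybe Bool
at []       _       = nothing
at (x ∷ s)  zero    = just x
at (x ∷ s)  (suc k) = at s k

_⊑_ : Seq → Seq → Set
s ⊑ t = ∃ λ u → s ++ u ≡ t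

meet : Seq → Seq → Seq
meet []       _        = []
meet (_ ∷ _)  []       = []
meet (x ∷ s)  (y ∷ t) with x ≟ y
... | yes _ = x ∷ meet s t
... | no  _ = []

data ℕω : Set where
  fin : ℕ → ℕω
  ω   : ℕω

_<ω_ : ℕ → ℕω → Set
n <ω fin m = n < m
n <ω ω     = ⊤

record IsTree (T : Seq → Set) : Set where
  field
    meet-closed : ∀ s t → T s → T t → T (meet s t)
    level-closed : ∀ s t → T s → T t → length s ≤ length t → T (take (length s) t)

-- A tree with coding nodes ⟨c n : n < N⟩ (values of c at n ≥ N are irrelevant).
record IsCodingTree (T : Seq → Set) (N : ℕω) (c : ℕ → Seq) : Set where
  field
    tree       : IsTree T
    coding-in  : ∀ n → n <ω N → T (c n)
    coding-inj : ∀ m n → m <ω N → n <ω N → c m ≡ c n → m ≡ n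
    coding-len : ∀ m n → m < n → n <ω N → length (c m) < length (c n)

-- A (simple) graph on vertex set {v_n : n < N}, vertices identified with indices.
record IsGraph (N : ℕω) (E : ℕ → ℕ → Set) : Set where
  field
    sym   : ∀ m n → m <ω N → n <ω N → E m n → E n m
    irrefl : ∀ n → n <ω N → ¬ E n n

Codes : ℕω → (ℕ → Seq) → (ℕ → ℕ → Set) → Set
Codes N c E = ∀ i n → i < n → n <ω N → (E n i ⇔ (at (c n) (length (c i)) ≡ just true))

Dense : (Seq → Set) → ℕω → (ℕ → Seq) → Set
Dense T N c = ∀ t → T t → ∃ λ n → n <ω N × t ⊑ c n

TriangleFree : ℕω → (ℕ → ℕ → Set) → Set
TriangleFree N E = ∀ a b d → a <ω N → b <ω N → d <ω N →
  a ≢ b → b ≢ d → a ≢ d → ¬ (E a b × E b d × E a d)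

TFC : (Seq → Set) → ℕω → (ℕ → Seq) → Set
TFC T N c = ∀ t → T t → ∀ n → n <ω N → length (c n) < length t → ∀ i → i < n →
  at t (length (c i)) ≡ just true → at (c n) (length (c i)) ≡ just true →
  at t (length (c n)) ≡ just false

-- A triangle is sorted as i < n < m, so it consists of the edges coded by c_m at
-- levels l_i and l_n together with the edge coded by c_n at level l_i. The criterion
-- applied to t = c_m forbids exactly such configurations. Conversely, a node t
-- violating the criterion extends, by density, to a coding node c_m with m > n whose
-- vertex then closes a triangle with v_n and v_i.
module Submission where

open import Defs
open import Data.Nat using (ℕ; zero; suc; _<_; _≤_; s≤s)
open import Data.Nat.Properties using (<-cmp; <-trans; <-irrefl; <-asym; <-≤-trans; m≤m+n; >⇒≢)
open import Data.Bool using (true; false)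
open import Data.List using (_∷_; length; _++_)
open import Data.List.Properties using (length-++)
open import Data.Maybe using (just)
open import Data.Product using (∃; _×_; _,_)
open import Data.Empty using (⊥; ⊥-elim)
open import Relation.Binary.Definitions using (Symmetric; tri<; tri≈; tri>)
open import Relation.Binary.PropositionalEquality using (_≡_; _≢_; refl; trans; sym; subst)
open import Function using (_∘_)
open import Function.Bundles using (_⇔_; mk⇔; Equivalence)
open import Function.Properties.Equivalence using () renaming (trans to ⇔-trans)

at-⊑ : ∀ {s t k b} → s ⊑ t → at s k ≡ just b → at t k ≡ just b
at-⊑ {x ∷ s} {k = zero}  (u , refl) e = e
at-⊑ {x ∷ s} {k = suc k} (u , refl) e = at-⊑ {s} (u , refl) e

at-defined : ∀ (s : Seq) {k} → k < length s → ∃ λ b → at s k ≡ just b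
at-defined (x ∷ s) {zero}  _         = x , refl
at-defined (x ∷ s) {suc k} (s≤s k<s) = at-defined s k<s

⊑⇒length≤ : ∀ {s t} → s ⊑ t → length s ≤ length t
⊑⇒length≤ {s} (u , refl) = subst (length s ≤_) (sym (length-++ s)) (m≤m+n _ _)

<ω-downward : ∀ {m n} N → m < n → n <ω N → m <ω N
<ω-downward (fin k) m<n n<k = <-trans m<n n<k
<ω-downward ω       _   _   = _

NoOrderedTriangle : (ℕ → ℕ → Set) → Set
NoOrderedTriangle R = ∀ {i n m} → i < n → n < m → R m n → R n i → R m i → ⊥

module _ {R : ℕ → ℕ → Set} (R-sym : Symmetric R) (no-ordered : NoOrderedTriangle R) where

  private
    insert : ∀ {x y z} → x < y → z ≢ x → z ≢ y → R y x → R z x → R z y → ⊥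
    insert {x} {y} {z} x<y z≢x z≢y yx zx zy with <-cmp z x
    ... | tri< z<x _ _ = no-ordered z<x x<y yx (R-sym zx) (R-sym zy)
    ... | tri≈ _ z≡x _ = z≢x z≡x
    ... | tri> _ _ x<z with <-cmp z y
    ...   | tri< z<y _ _ = no-ordered x<z z<y (R-sym zy) zx yx
    ...   | tri≈ _ z≡y _ = z≢y z≡y
    ...   | tri> _ _ y<z = no-ordered x<y y<z zy yx zx

  no-triangle : ∀ {x y z} → x ≢ y → y ≢ z → x ≢ z → R x y → R y z → R x z → ⊥
  no-triangle {x} {y} x≢y y≢z x≢z xy yz xz with <-cmp x y
  ... | tri< x<y _ _ = insert x<y (x≢z ∘ sym) (y≢z ∘ sym) (R-sym xy) (R-sym xz) (R-sym yz)
  ... | tri≈ _ x≡y _ = x≢y x≡y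
  ... | tri> _ _ y<x = insert y<x (y≢z ∘ sym) (x≢z ∘ sym) xy (R-sym yz) (R-sym xz)

Edge : ℕω → (ℕ → ℕ → Set) → ℕ → ℕ → Set
Edge N E x y = x <ω N × y <ω N × E x y

module _ {N : ℕω} {E : ℕ → ℕ → Set} (G : IsGraph N E) where

  Edge-sym : Symmetric (Edge N E)
  Edge-sym (xN , yN , xy) = yN , xN , IsGraph.sym G _ _ xN yN xy

  triangle-free⇔no-ordered-triangle : TriangleFree N E ⇔ NoOrderedTriangle (Edge N E)
  triangle-free⇔no-ordered-triangle = mk⇔ ordered sorted
    where
    ordered : TriangleFree N E → NoOrderedTriangle (Edge N E)
    ordered tf i<n n<m (mN , nN , mn) (_ , iN , ni) (_ , _ , mi) =
      tf _ _ _ mN nN iN (>⇒≢ n<m) (>⇒≢ i<n) (>⇒≢ (<-trans i<n n<m)) (mn , ni , mi)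

    sorted : NoOrderedTriangle (Edge N E) → TriangleFree N E
    sorted no-ordered a b d aN bN dN a≢b b≢d a≢d (ab , bd , ad) =
      no-triangle Edge-sym no-ordered a≢b b≢d a≢d (aN , bN , ab) (bN , dN , bd) (aN , dN , ad)

module _ {N : ℕω} {T : Seq → Set} {c : ℕ → Seq} {E : ℕ → ℕ → Set}
         (CT : IsCodingTree T N c) (C : Codes N c E) where
  open IsCodingTree CT
  open Equivalence

  coding-len-reflects-< : ∀ {n m} → n <ω N → length (c n) < length (c m) → n < m
  coding-len-reflects-< {n} {m} nN lₙ<lₘ with <-cmp n m
  ... | tri< n<m _ _ = n<m
  ... | tri≈ _ refl _ = ⊥-elim (<-irrefl refl lₙ<lₘ)
  ... | tri> _ _ m<n = ⊥-elim (<-asym lₙ<lₘ (coding-len m n m<n nN))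

  edge⇒coded : ∀ {i n} → i < n → Edge N E n i → at (c n) (length (c i)) ≡ just true
  edge⇒coded i<n (nN , _ , ni) = to (C _ _ i<n nN) ni

  coded⇒edge : ∀ {i n} → i < n → n <ω N → at (c n) (length (c i)) ≡ just true → Edge N E n i
  coded⇒edge i<n nN cₙ[lᵢ]≡1 = nN , <ω-downward N i<n nN , from (C _ _ i<n nN) cₙ[lᵢ]≡1

  tfc⇒no-ordered-triangle : TFC T N c → NoOrderedTriangle (Edge N E)
  tfc⇒no-ordered-triangle tfc {i} {n} {m} i<n n<m mn@(mN , nN , _) ni mi
    with trans (sym (tfc (c m) (coding-in m mN) n nN (coding-len n m n<m mN) i i<n
                         (edge⇒coded (<-trans i<n n<m) mi) (edge⇒coded i<n ni)))
               (edge⇒coded n<m mn)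
  ... | ()

  coding-node-above : Dense T N c → ∀ {t n} → T t → n <ω N → length (c n) < length t →
                      ∃ λ m → n < m × m <ω N × t ⊑ c m
  coding-node-above dense Tt nN lₙ<|t| with dense _ Tt
  ... | m , mN , t⊑cₘ = m , coding-len-reflects-< nN (<-≤-trans lₙ<|t| (⊑⇒length≤ t⊑cₘ)) , mN , t⊑cₘ

  no-ordered-triangle⇒tfc : Dense T N c → NoOrderedTriangle (Edge N E) → TFC T N c
  no-ordered-triangle⇒tfc dense no-ordered t Tt n nN lₙ<|t| i i<n t[lᵢ]≡1 cₙ[lᵢ]≡1
    with at-defined t lₙ<|t|
  ... | false , t[lₙ]≡0 = t[lₙ]≡0
  ... | true  , t[lₙ]≡1 with coding-node-above dense Tt nN lₙ<|t|
  ...   | m , n<m , mN , t⊑cₘ =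
    ⊥-elim (no-ordered i<n n<m (coded⇒edge n<m mN (at-⊑ t⊑cₘ t[lₙ]≡1))
                               (coded⇒edge i<n nN cₙ[lᵢ]≡1)
                               (coded⇒edge (<-trans i<n n<m) mN (at-⊑ t⊑cₘ t[lᵢ]≡1)))

proposition3p6 : (N : ℕω) (T : Seq → Set) (c : ℕ → Seq) (E : ℕ → ℕ → Set) →
    IsCodingTree T N c → IsGraph N E → Codes N c E → Dense T N c →
    (TriangleFree N E ⇔ TFC T N c)
proposition3p6 N T c E CT G C dense =
  ⇔-trans (triangle-free⇔no-ordered-triangle G)
          (mk⇔ (no-ordered-triangle⇒tfc CT C dense) (tfc⇒no-ordered-triangle CT C))
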